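{- Let $h(x)$ be a polynomial with real coefficients and let $F_{h,n}^l(x)=\sum_{i=0}^{l}\binom{n-1-i}{i}h^{n-2i-1}(x)$ for integers $n\ge 1$ and $0\le l\le\lfloor (n-1)/2\rfloor$. Then for all integers $s\ge 0$, $n\ge 1$ and $l$ with $0\le l\le \frac{n-s-1}{2}$, $$\sum_{i=0}^{s}\binom{s}{i}F_{h,n+i}^{l+i}(x)\,h^{i}(x)=F_{h,n+2s}^{l+s}(x).$$
   Context: $h(x)$ is a polynomial with real coefficients; $h^k(x)$ denotes $(h(x))^k$. $F_{h,n}^l(x)$ are the incomplete $h(x)$-Fibonacci polynomials. -}

module Defs where

open import Level using (Level)
open import Algebra.Bundles using (CommutativeRing; Semiring)
open import Data.Nat using (ℕ; suc; _∸_; _*_)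
open import Data.Nat.Combinatorics using (_C_)
open import Data.Fin using (Fin; toℕ)

-- Incomplete h-Fibonacci polynomials, over an arbitrary commutative ring R
-- (the paper's setting is R = ℝ[x], with h ∈ ℝ[x]).
module IncompleteFib {c ℓ : Level} (R : CommutativeRing c ℓ) where
  open CommutativeRing R using (Carrier; semiring)
  open import Algebra.Definitions.RawSemiring (Semiring.rawSemiring semiring) using (_×_; _^_; sum)

  F : Carrier → ℕ → ℕ → Carrier
  F h n l = sum {suc l} (λ (i : Fin (suc l)) →
              ((n ∸ 1 ∸ toℕ i) C toℕ i) × (h ^ (n ∸ 2 * toℕ i ∸ 1)))

module Submission where

-- For 2k + 2 ≤ m the incomplete h-Fibonacci polynomials satisfy
--   F(m+2, k+1) = F(m, k) + h F(m+1, k+1),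
-- proved termwise by Pascal's rule (the head term h^(m+1) is h times h^m).
-- The proposition is the s-fold iterate of this recurrence: by induction on s,
-- splitting C(s+1,i) = C(s,i) + C(s,i-1) writes the sum for s+1 at (n,l) as the
-- sum for s at (n,l) plus h times the sum for s at (n+1,l+1), and the induction
-- hypothesis and the recurrence at (m,k) = (n+2s, l+s) combine the two.

open import Defs
open import Level using (Level)
open import Algebra.Bundles using (CommutativeRing; Semiring)
open import Data.Nat using (ℕ; zero; suc; _≤_; _∸_; s≤s)
import Data.Nat as N
open import Data.Nat.Properties as NP using (+-suc; m≤n⇒∃[o]m+o≡n; m+n∸m≡n; ∸-+-assoc)
open import Data.Nat.Combinatorics using (_C_; nCk+nC[k+1]≡[n+1]C[k+1]; k>n⇒nCk≡0)
open import Data.Nat.Tactic.RingSolver using (solve)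
open import Data.List using (_∷_; [])
open import Data.Fin using (Fin; toℕ)
open import Data.Fin.Properties using (toℕ-inject₁; toℕ-fromℕ; toℕ≤pred[n])
open import Data.Product using (_,_)
open import Function using (_∘_)
import Algebra.Definitions.RawSemiring as RS
import Algebra.Properties.CommutativeSemigroup as CS
open import Relation.Binary.PropositionalEquality as ≡ using (_≡_; refl)

module BinomialSums {c ℓ : Level} (S : Semiring c ℓ) where
  open Semiring S
  open import Algebra.Properties.Semiring.Sum S
  open import Algebra.Properties.Semiring.Mult S
  open import Relation.Binary.Reasoning.Setoid setoid

  binomialSum : ℕ → (ℕ → Carrier) → Carrier
  binomialSum s a = sum {suc s} λ i → (s C toℕ i) × a (toℕ i)

  binomialSum-cong : ∀ s {a b : ℕ → Carrier} → (∀ i → a i ≈ b i) → binomialSum s a ≈ binomialSum s b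
  binomialSum-cong s a≈b = sum-cong-≋ {suc s} (λ i → ×-congʳ (s C toℕ i) (a≈b (toℕ i)))

  *-distribˡ-binomialSum : ∀ s x (a : ℕ → Carrier) → x * binomialSum s a ≈ binomialSum s (λ i → x * a i)
  *-distribˡ-binomialSum s x a = trans (*-distribˡ-sum {suc s} x (λ i → (s C toℕ i) × a (toℕ i)))
                                       (sum-cong-≋ {suc s} (λ i → ×-comm-* (s C toℕ i) x (a (toℕ i))))

  ×-pascal : ∀ n k x → (suc n C suc k) × x ≈ (n C k) × x + (n C suc k) × x
  ×-pascal n k x = trans (reflexive (≡.cong (_× x) (≡.sym (nCk+nC[k+1]≡[n+1]C[k+1] n k))))
                         (×-homo-+ x (n C k) (n C suc k))

  sum-toℕ-last : ∀ n (g : ℕ → Carrier) → sum {suc n} (g ∘ toℕ) ≈ sum {n} (g ∘ toℕ) + g n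
  sum-toℕ-last n g = trans (sum-init-last {n} (g ∘ toℕ))
    (+-cong (sum-cong-≋ {n} (reflexive ∘ ≡.cong g ∘ toℕ-inject₁)) (reflexive (≡.cong g (toℕ-fromℕ n))))

  binomialSum-extend : ∀ s a → sum {suc (suc s)} (λ i → (s C toℕ i) × a (toℕ i)) ≈ binomialSum s a
  binomialSum-extend s a = begin
    sum {suc (suc s)} (λ i → (s C toℕ i) × a (toℕ i))
      ≈⟨ sum-toℕ-last (suc s) (λ i → (s C i) × a i) ⟩
    binomialSum s a + (s C suc s) × a (suc s)
      ≈⟨ +-congˡ (reflexive (≡.cong (_× a (suc s)) (k>n⇒nCk≡0 (NP.n<1+n s)))) ⟩
    binomialSum s a + 0#
      ≈⟨ +-identityʳ _ ⟩
    binomialSum s a ∎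

  binomialSum-suc : ∀ s a → binomialSum (suc s) a ≈ binomialSum s a + binomialSum s (a ∘ suc)
  binomialSum-suc s a = begin
    a₀ + sum {suc s} (λ j → (suc s C suc (toℕ j)) × a (suc (toℕ j)))
      ≈⟨ +-congˡ (sum-cong-≋ {suc s} (λ j → ×-pascal s (toℕ j) (a (suc (toℕ j))))) ⟩
    a₀ + sum {suc s} (λ j → (s C toℕ j) × a (suc (toℕ j)) + (s C suc (toℕ j)) × a (suc (toℕ j)))
      ≈⟨ +-congˡ (∑-distrib-+ {suc s} (λ j → (s C toℕ j) × a (suc (toℕ j))) (λ j → (s C suc (toℕ j)) × a (suc (toℕ j)))) ⟩
    a₀ + (binomialSum s (a ∘ suc) + sum {suc s} (λ j → (s C suc (toℕ j)) × a (suc (toℕ j))))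
      ≈⟨ CS.x∙yz≈xz∙y +-commutativeSemigroup _ _ _ ⟩
    sum {suc (suc s)} (λ i → (s C toℕ i) × a (toℕ i)) + binomialSum s (a ∘ suc)
      ≈⟨ +-congʳ (binomialSum-extend s a) ⟩
    binomialSum s a + binomialSum s (a ∘ suc) ∎
    where a₀ = (s C 0) × a 0

∸∸-eval : ∀ x a b c → x ≡ a N.+ b N.+ c → x ∸ a ∸ b ≡ c
∸∸-eval x a b c x≡a+b+c = ≡.trans (∸-+-assoc x a b)
  (≡.subst (λ y → y ∸ (a N.+ b) ≡ c) (≡.sym x≡a+b+c) (m+n∸m≡n (a N.+ b) c))

module _ (l s : ℕ) {n : ℕ} (2l+s+2≤n : 2 N.* l N.+ suc s N.+ 1 ≤ n) where
  open NP.≤-Reasoning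

  2l+s+2≤n⇒2[l+1]+s+1≤n+1 : 2 N.* suc l N.+ s N.+ 1 ≤ suc n
  2l+s+2≤n⇒2[l+1]+s+1≤n+1 = begin
    2 N.* suc l N.+ s N.+ 1          ≡⟨ solve (l ∷ s ∷ []) ⟩
    suc (2 N.* l N.+ suc s N.+ 1)    ≤⟨ s≤s 2l+s+2≤n ⟩
    suc n                            ∎

  2l+s+2≤n⇒2[l+s]+2≤n+2s : 2 N.* (l N.+ s) N.+ 2 ≤ n N.+ 2 N.* s
  2l+s+2≤n⇒2[l+s]+2≤n+2s = begin
    2 N.* (l N.+ s) N.+ 2            ≡⟨ solve (l ∷ s ∷ []) ⟩
    (2 N.* l N.+ suc s N.+ 1) N.+ s  ≤⟨ NP.+-mono-≤ 2l+s+2≤n (NP.m≤m+n s (1 N.* s)) ⟩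
    n N.+ 2 N.* s                    ∎

module IncompleteFibProperties {c ℓ : Level} (R : CommutativeRing c ℓ) where
  open CommutativeRing R
  open RS (Semiring.rawSemiring semiring) using (_×_; _^_; sum)
  open IncompleteFib R
  open BinomialSums semiring
  open import Algebra.Properties.Semiring.Sum semiring using (sum-cong-≋; ∑-distrib-+; *-distribˡ-sum)
  open import Algebra.Properties.Semiring.Mult semiring using (×-comm-*; ×-homo-1)
  open import Relation.Binary.Reasoning.Setoid setoid

  term : Carrier → ℕ → ℕ → Carrier
  term h n i = ((n ∸ 1 ∸ i) C i) × (h ^ (n ∸ 2 N.* i ∸ 1))

  -- Writing n = 2i + 1 + e turns the truncated subtractions of `term` into genuine ones.
  term-canonical : ∀ h n i e → n ≡ 2 N.* i N.+ suc e → term h n i ≈ ((i N.+ e) C i) × (h ^ e)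
  term-canonical h _ i e refl =
    reflexive (≡.cong₂ (λ a b → (a C i) × (h ^ b))
      (∸∸-eval (2 N.* i N.+ suc e) 1 i (i N.+ e) (solve (i ∷ e ∷ [])))
      (∸∸-eval (2 N.* i N.+ suc e) (2 N.* i) 1 e (solve (i ∷ e ∷ []))))

  term-recurrence : ∀ h {m j} → 2 N.* j N.+ 2 ≤ m →
                    term h (2 N.+ m) (suc j) ≈ term h m j + h * term h (suc m) (suc j)
  term-recurrence h {j = j} 2j+2≤m with m≤n⇒∃[o]m+o≡n 2j+2≤m
  ... | r , refl = begin
    term h (2 N.+ m) (suc j)
      ≈⟨ term-canonical h (2 N.+ (2 N.* j N.+ 2 N.+ r)) (suc j) (suc r) (solve (j ∷ r ∷ [])) ⟩
    (suc N C suc j) × (h ^ suc r)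
      ≈⟨ ×-pascal N j (h ^ suc r) ⟩
    (N C j) × (h ^ suc r) + (N C suc j) × (h * h ^ r)
      ≈⟨ +-cong (term-canonical h (2 N.* j N.+ 2 N.+ r) j (suc r) (solve (j ∷ r ∷ [])))
                (×-comm-* (N C suc j) h (h ^ r)) ⟨
    term h m j + h * ((N C suc j) × (h ^ r))
      ≈⟨ +-congˡ (*-congˡ shifted) ⟨
    term h m j + h * term h (suc m) (suc j) ∎
    where
    m = 2 N.* j N.+ 2 N.+ r
    N = j N.+ suc r
    shifted : term h (suc m) (suc j) ≈ (N C suc j) × (h ^ r)
    shifted = trans (term-canonical h (suc (2 N.* j N.+ 2 N.+ r)) (suc j) r (solve (j ∷ r ∷ [])))
                    (reflexive (≡.cong (λ a → (a C suc j) × (h ^ r)) (≡.sym (+-suc j r))))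

  F-recurrence : ∀ h {m k} → 2 N.* k N.+ 2 ≤ m → F h (2 N.+ m) (suc k) ≈ F h m k + h * F h (suc m) (suc k)
  F-recurrence h {m} {k} 2k+2≤m = begin
    term h (2 N.+ m) 0 + sum {suc k} (λ j → term h (2 N.+ m) (suc (toℕ j)))
      ≈⟨ +-cong head≈ (sum-cong-≋ {suc k} (λ j → term-recurrence h {m} {toℕ j} (bound j))) ⟩
    h * t₀ + sum {suc k} (λ j → term h m (toℕ j) + h * t (toℕ j))
      ≈⟨ +-congˡ (∑-distrib-+ {suc k} (term h m ∘ toℕ) (λ j → h * t (toℕ j))) ⟩
    h * t₀ + (F h m k + sum {suc k} (λ j → h * t (toℕ j)))
      ≈⟨ +-congˡ (+-congˡ (*-distribˡ-sum {suc k} h (t ∘ toℕ))) ⟨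
    h * t₀ + (F h m k + h * sum {suc k} (t ∘ toℕ))
      ≈⟨ CS.x∙yz≈y∙xz +-commutativeSemigroup _ _ _ ⟩
    F h m k + (h * t₀ + h * sum {suc k} (t ∘ toℕ))
      ≈⟨ +-congˡ (distribˡ h t₀ _) ⟨
    F h m k + h * F h (suc m) (suc k) ∎
    where
    t₀ = term h (suc m) 0
    t = λ j → term h (suc m) (suc j)
    head≈ : term h (2 N.+ m) 0 ≈ h * t₀
    head≈ = trans (×-homo-1 (h ^ suc m)) (*-congˡ (sym (×-homo-1 (h ^ m))))
    bound : (j : Fin (suc k)) → 2 N.* toℕ j N.+ 2 ≤ m
    bound j = NP.≤-trans (NP.+-monoˡ-≤ 2 (NP.*-monoʳ-≤ 2 (toℕ≤pred[n] j))) 2k+2≤m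

  binomialSum-F : ∀ h s {n l} → 2 N.* l N.+ s N.+ 1 ≤ n →
                  binomialSum s (λ i → F h (n N.+ i) (l N.+ i) * h ^ i) ≈ F h (n N.+ 2 N.* s) (l N.+ s)
  binomialSum-F h zero _ = trans (+-identityʳ _) (trans (×-homo-1 _) (*-identityʳ _))
  binomialSum-F h (suc s) {n} {l} 2l+s+2≤n = begin
    binomialSum (suc s) a
      ≈⟨ binomialSum-suc s a ⟩
    binomialSum s a + binomialSum s (a ∘ suc)
      ≈⟨ +-congˡ (binomialSum-cong s shift) ⟩
    binomialSum s a + binomialSum s (λ i → h * a′ i)
      ≈⟨ +-congˡ (*-distribˡ-binomialSum s h a′) ⟨
    binomialSum s a + h * binomialSum s a′
      ≈⟨ +-cong (binomialSum-F h s {n} {l} 2l+s+1≤n)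
                (*-congˡ (binomialSum-F h s {suc n} {suc l} (2l+s+2≤n⇒2[l+1]+s+1≤n+1 l s 2l+s+2≤n))) ⟩
    F h (n N.+ 2 N.* s) (l N.+ s) + h * F h (suc n N.+ 2 N.* s) (suc l N.+ s)
      ≈⟨ F-recurrence h {n N.+ 2 N.* s} {l N.+ s} (2l+s+2≤n⇒2[l+s]+2≤n+2s l s 2l+s+2≤n) ⟨
    F h (2 N.+ (n N.+ 2 N.* s)) (suc (l N.+ s))
      ≡⟨ ≡.cong₂ (F h) 2+[n+2s]≡n+2[1+s] (≡.sym (+-suc l s)) ⟩
    F h (n N.+ 2 N.* suc s) (l N.+ suc s) ∎
    where
    a a′ : ℕ → Carrier
    a i = F h (n N.+ i) (l N.+ i) * h ^ i
    a′ i = F h (suc n N.+ i) (suc l N.+ i) * h ^ i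
    shift : ∀ i → a (suc i) ≈ h * a′ i
    shift i = trans (reflexive (≡.cong₂ (λ x y → F h x y * (h * h ^ i)) (+-suc n i) (+-suc l i)))
                    (CS.x∙yz≈y∙xz *-commutativeSemigroup _ h _)
    2+[n+2s]≡n+2[1+s] : 2 N.+ (n N.+ 2 N.* s) ≡ n N.+ 2 N.* suc s
    2+[n+2s]≡n+2[1+s] = solve (n ∷ s ∷ [])
    2l+s+1≤n : 2 N.* l N.+ s N.+ 1 ≤ n
    2l+s+1≤n = NP.≤-trans (NP.+-monoˡ-≤ 1 (NP.+-monoʳ-≤ (2 N.* l) (NP.n≤1+n s))) 2l+s+2≤n

proposition3 : {c ℓ : Level} (R : CommutativeRing c ℓ) →
    let open CommutativeRing R
        open RS (Semiring.rawSemiring semiring)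
        open IncompleteFib R
    in (h : Carrier) (s n l : ℕ) → 1 ≤ n → 2 N.* l N.+ s N.+ 1 ≤ n →
       sum {suc s} (λ (i : Fin (suc s)) →
         (s C toℕ i) × (F h (n N.+ toℕ i) (l N.+ toℕ i) * (h ^ toℕ i)))
       ≈ F h (n N.+ 2 N.* s) (l N.+ s)
proposition3 R h s n l _ = IncompleteFibProperties.binomialSum-F R h s {n} {l}
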